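{- Let $\alpha$ be an irrational real number, $N\ge1$, and $S_\alpha(N)=\{\{n\alpha\}:1\le n\le N\}\subset\mathbb{R}/\mathbb{Z}$. Suppose $\{n_1\alpha\},\{n_2\alpha\},\dots,\{n_k\alpha\}$ (with $1\le n_j\le N$) are consecutive elements of $S_\alpha(N)$. Then $\{(N+1-n_k)\alpha\},\dots,\{(N+1-n_2)\alpha\},\{(N+1-n_1)\alpha\}$ are consecutive elements of $S_\alpha(N)$.
   Context: $\{x\}$ is the fractional part; $\mathbb{R}/\mathbb{Z}$ is identified with $[0,1)$. "Consecutive elements" of $S_\alpha(N)$ means consecutive with respect to the cyclic order of the points on $\mathbb{R}/\mathbb{Z}$ (listing $S_\alpha(N)=\{a_1<\dots<a_N\}$ with $a_{i+N}=a_i$, a list of consecutive elements is $a_i,a_{i+1},\dots,a_{i+k-1}$). -}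

module Defs where

open import Data.Bool using (Bool; true; false; not)
open import Data.Nat as ℕ using (ℕ; suc; _∸_)
open import Data.Integer as ℤ using (ℤ; +_; -[1+_]; +[1+_])
import Data.Integer.Properties as ℤP
open import Data.Rational as ℚ using (ℚ; _/_)
open import Data.Product using (Σ; ∃; _×_)
open import Data.Sum using (_⊎_)
open import Data.List using (List; []; _∷_; map; reverse)
open import Relation.Nullary using (¬_; does)
open import Relation.Binary.PropositionalEquality using (_≡_)

-- An irrational real number α, encoded as a Dedekind cut on ℚ:
-- below q ≡ true  iff  q < α.
-- (noMin of the upper set is exactly what excludes rational α.)
record IrrationalReal : Set where
  field
    below          : ℚ → Bool
    downClosed     : ∀ {p q} → p ℚ.≤ q → below q ≡ true → below p ≡ true
    lowerInhabited : ∃ λ q → below q ≡ true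
    upperInhabited : ∃ λ q → below q ≡ false
    noMax          : ∀ q → below q ≡ true → ∃ λ r → q ℚ.< r × below r ≡ true
    noMin          : ∀ q → below q ≡ false → ∃ λ r → r ℚ.< q × below r ≡ false
open IrrationalReal public

-- mulLt α c d  decides  c·α < d  (c, d integers).
mulLt : IrrationalReal → ℤ → ℤ → Bool
mulLt α (+ 0)      d = does (+ 0 ℤP.<? d)
mulLt α +[1+ k ]   d = not (below α (d / suc k))
mulLt α (-[1+ k ]) d = below α ((ℤ.- d) / suc k)

-- a = ⌊ n α ⌋  (a < nα < a+1; equality impossible for α irrational, n ≥ 1)
IsFloor : IrrationalReal → ℕ → ℤ → Set
IsFloor α n a = (mulLt α (ℤ.- (+ n)) (ℤ.- a) ≡ true) × (mulLt α (+ n) (a ℤ.+ + 1) ≡ true)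

-- {nα} < {mα}  (as elements of [0,1)):  nα - ⌊nα⌋ < mα - ⌊mα⌋
FracLt : IrrationalReal → ℕ → ℕ → Set
FracLt α n m = Σ ℤ λ a → Σ ℤ λ b →
  IsFloor α n a × IsFloor α m b × (mulLt α (+ n ℤ.- + m) (a ℤ.- b) ≡ true)

-- strict cyclic betweenness on ℝ/ℤ: going forward from {xα} one meets {zα} strictly before {yα}
CycBetween : IrrationalReal → ℕ → ℕ → ℕ → Set
CycBetween α x z y =
  (FracLt α x z × FracLt α z y) ⊎ (FracLt α z y × FracLt α y x) ⊎ (FracLt α y x × FracLt α x z)

CycSucc : IrrationalReal → ℕ → ℕ → ℕ → Set
CycSucc α N n m =
  (n ≡ m → N ≡ 1) ×
  (∀ p → 1 ℕ.≤ p → p ℕ.≤ N → ¬ CycBetween α n p m)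

Consecutive : IrrationalReal → ℕ → List ℕ → Set
Consecutive α N []            = Data.Unit.⊤ where import Data.Unit
Consecutive α N (x ∷ [])      = Data.Unit.⊤ where import Data.Unit
Consecutive α N (x ∷ y ∷ xs)  = CycSucc α N x y × Consecutive α N (y ∷ xs)

reflectList : ℕ → List ℕ → List ℕ
reflectList N ns = reverse (map (λ n → suc N ∸ n) ns)

{-# OPTIONS --safe #-}
-- Write {x} for the fractional part. For 1 ≤ s < K,
--   ⌊(K−s)α⌋ = ⌊Kα⌋ − ⌊sα⌋ − [{sα} > {Kα}],
-- so s ↦ K − s acts on the points {sα} as the reflection y ↦ {Kα} − y of ℝ/ℤ. Two
-- reflected points therefore compare in reverse order when they lie on the same side of
-- {Kα}, and according to their sides otherwise; either way the majority of the three
-- pairwise comparisons, which is cyclic betweenness, is reversed. For K = N + 1 the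
-- reflection maps S_α(N) onto itself, so it swaps cyclic successors and reverses runs of
-- consecutive points. Every comparison is a strict inequality c·α < d between integers,
-- decided by the Dedekind cut; such inequalities can be added because both halves of the
-- cut are closed under mediants.
module Submission where

open import Defs
open import Data.Bool using (Bool; true; false; not; _xor_)
open import Data.Empty using (⊥; ⊥-elim)
open import Data.Integer as ℤ using (ℤ; +_; -[1+_]; +[1+_]; _+_; _-_; _*_; -_; _<_; _≤_)
import Data.Integer.Properties as ℤP
open import Data.Integer.Tactic.RingSolver using (solve-∀)
open import Data.List using (List; reverse; reverseAcc; map; _∷_; [])
open import Data.List.Relation.Unary.All using (All; _∷_)
open import Data.Nat as ℕ using (ℕ; zero; suc; _∸_)
import Data.Nat.Properties as ℕP
open import Data.Product using (∃; _×_; _,_; proj₁; proj₂)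
open import Data.Rational as ℚ using (ℚ; _/_)
import Data.Rational.Properties as ℚP
open import Data.Rational.Unnormalised using (mkℚᵘ; *≤*)
import Data.Rational.Unnormalised.Properties as ℚᵘP
open import Data.Sum using (_⊎_; inj₁; inj₂)
open import Data.Unit using (tt)
open import Function using (case_of_)
open import Relation.Binary.PropositionalEquality
open import Relation.Nullary using (¬_; Dec; yes; no; does)

private
  does-sound : ∀ {P : Set} (p? : Dec P) → does p? ≡ true → P
  does-sound (yes p) _ = p

  does-complete : ∀ {P : Set} (p? : Dec P) → P → does p? ≡ true
  does-complete (yes _) _  = refl
  does-complete (no ¬p) p = ⊥-elim (¬p p)

  not-true : ∀ {b} → not b ≡ true → b ≡ false
  not-true {false} _ = refl

  not-false : ∀ {b} → not b ≡ false → b ≡ true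
  not-false {true} _ = refl

i-j≡-[j-i] : ∀ i j → i - j ≡ - (j - i)
i-j≡-[j-i] = solve-∀

+-mono-<-≢ : ∀ {a b c e} → a < b → c < e → a + c ≢ b + e
+-mono-<-≢ a<b c<e eq = ℤP.<-irrefl eq (ℤP.+-mono-< a<b c<e)

0<i-j⇒j<i : ∀ {i j} → + 0 < i - j → j < i
0<i-j⇒j<i {i} {j} 0<i-j = subst₂ _<_ (ℤP.+-identityʳ j) (j+[i-j]≡i j i) (ℤP.+-monoʳ-< j 0<i-j)
  where
  j+[i-j]≡i : ∀ j i → j + (i - j) ≡ i
  j+[i-j]≡i = solve-∀

i≤+∣i∣ : ∀ i → i ≤ + ℤ.∣ i ∣
i≤+∣i∣ (+ _)      = ℤP.≤-refl
i≤+∣i∣ -[1+ _ ]   = ℤ.-≤+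

+[m∸n]≡m-n : ∀ {m n} → n ℕ.≤ m → + (m ∸ n) ≡ + m - + n
+[m∸n]≡m-n {m} {n} n≤m = trans (sym (ℤP.⊖-≥ n≤m)) (sym (ℤP.m-n≡m⊖n m n))

∃-true-then-false : (f : ℕ → Bool) → f 0 ≡ true → ∀ M → f M ≡ false →
                    ∃ λ i → f i ≡ true × f (suc i) ≡ false
∃-true-then-false f f0 zero fM with () ← trans (sym f0) fM
∃-true-then-false f f0 (suc M) fM with f M in fM-1
... | true  = M , fM-1 , fM
... | false = ∃-true-then-false f f0 M fM-1

maj : Bool → Bool → Bool → Bool
maj true  true  _ = true
maj false false _ = false
maj true  false z = z
maj false true  z = z

maj-comm : ∀ x y z → maj x y z ≡ maj y x z
maj-comm true  true  _ = refl
maj-comm true  false _ = refl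
maj-comm false true  _ = refl
maj-comm false false _ = refl

maj-cong : ∀ {x x′ y y′ z z′} → x ≡ x′ → y ≡ y′ → z ≡ z′ → maj x y z ≡ maj x′ y′ z′
maj-cong refl refl refl = refl

maj-intro : ∀ {x y z} →
  (x ≡ true × y ≡ true) ⊎ (y ≡ true × z ≡ true) ⊎ (z ≡ true × x ≡ true) → maj x y z ≡ true
maj-intro (inj₁ (refl , refl))                = refl
maj-intro {true}  (inj₂ (inj₁ (refl , refl))) = refl
maj-intro {false} (inj₂ (inj₁ (refl , refl))) = refl
maj-intro {y = true}  (inj₂ (inj₂ (refl , refl))) = refl
maj-intro {y = false} (inj₂ (inj₂ (refl , refl))) = refl

maj-elim : ∀ {x y z} → maj x y z ≡ true →
  (x ≡ true × y ≡ true) ⊎ (y ≡ true × z ≡ true) ⊎ (z ≡ true × x ≡ true)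
maj-elim {true}  {true}  _ = inj₁ (refl , refl)
maj-elim {true}  {false} z = inj₂ (inj₂ (z , refl))
maj-elim {false} {true}  z = inj₂ (inj₁ (refl , z))

-- If the cut separates one point from the other two, two comparisons are flipped and
-- the hypotheses make them opposite, so the majority is decided by the third.
maj-flip-across-cut : ∀ ea eb ec x y z →
  (ea ≢ eb → x ≡ eb) → (eb ≢ ec → y ≡ ec) → (ec ≢ ea → z ≡ ea) →
  maj ((ea xor eb) xor x) ((eb xor ec) xor y) ((ec xor ea) xor z) ≡ maj x y z
maj-flip-across-cut false false false x y z _ _ _ = refl
maj-flip-across-cut true  true  true  x y z _ _ _ = refl
maj-flip-across-cut true  true  false true  y z _ hy hz rewrite hy (λ ()) | hz (λ ()) = refl
maj-flip-across-cut true  true  false false y z _ hy hz rewrite hy (λ ()) | hz (λ ()) = refl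
maj-flip-across-cut false false true  true  y z _ hy hz rewrite hy (λ ()) | hz (λ ()) = refl
maj-flip-across-cut false false true  false y z _ hy hz rewrite hy (λ ()) | hz (λ ()) = refl
maj-flip-across-cut true  false true  x y z hx hy _ rewrite hx (λ ()) | hy (λ ()) = refl
maj-flip-across-cut false true  false x y z hx hy _ rewrite hx (λ ()) | hy (λ ()) = refl
maj-flip-across-cut true  false false x true  z hx _ hz rewrite hx (λ ()) | hz (λ ()) = refl
maj-flip-across-cut true  false false x false z hx _ hz rewrite hx (λ ()) | hz (λ ()) = refl
maj-flip-across-cut false true  true  x true  z hx _ hz rewrite hx (λ ()) | hz (λ ()) = refl
maj-flip-across-cut false true  true  x false z hx _ hz rewrite hx (λ ()) | hz (λ ()) = refl

module _ (α : IrrationalReal) where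

  below[_/1+_] : ℤ → ℕ → Bool
  below[ e /1+ j ] = below α (e / suc j)

  below-mono : ∀ e j e′ j′ → e′ * + suc j ≤ e * + suc j′ →
               below[ e /1+ j ] ≡ true → below[ e′ /1+ j′ ] ≡ true
  below-mono e j e′ j′ cross = downClosed α e′/j′≤e/j
    where
    e′/j′≤e/j : e′ / suc j′ ℚ.≤ e / suc j
    e′/j′≤e/j = ℚP.toℚᵘ-cancel-≤ (ℚᵘP.≤-respʳ-≃ (ℚᵘP.≃-sym (ℚP.toℚᵘ-fromℚᵘ (mkℚᵘ e j)))
                  (ℚᵘP.≤-respˡ-≃ (ℚᵘP.≃-sym (ℚP.toℚᵘ-fromℚᵘ (mkℚᵘ e′ j′))) (*≤* cross)))

  above-mono : ∀ e j e′ j′ → e′ * + suc j ≤ e * + suc j′ →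
               below[ e′ /1+ j′ ] ≡ false → below[ e /1+ j ] ≡ false
  above-mono e j e′ j′ cross above with below[ e /1+ j ] in b
  ... | false = refl
  ... | true with () ← trans (sym (below-mono e j e′ j′ cross b)) above

  below-separates : ∀ e j e′ j′ → below[ e /1+ j ] ≡ true → below[ e′ /1+ j′ ] ≡ false →
                    e * + suc j′ < e′ * + suc j
  below-separates e j e′ j′ b b′ =
    ℤP.≰⇒> λ cross → case trans (sym (below-mono e j e′ j′ cross b)) b′ of λ ()

  private
    mediant-split : ∀ d d′ a a′ → (d + d′) * a + (d + d′) * a′ ≡ d * (a + a′) + d′ * (a + a′)
    mediant-split = solve-∀

  below-mediant : ∀ d j d′ j′ → below[ d /1+ j ] ≡ true → below[ d′ /1+ j′ ] ≡ true →
                  below[ d + d′ /1+ j ℕ.+ suc j′ ] ≡ true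
  below-mediant d j d′ j′ b b′ with below[ d + d′ /1+ j ℕ.+ suc j′ ] in m
  ... | true  = refl
  ... | false = ⊥-elim (+-mono-<-≢ (below-separates d j (d + d′) k b m)
                                   (below-separates d′ j′ (d + d′) k b′ m)
                          (sym (mediant-split d d′ (+ suc j) (+ suc j′))))
    where
    k : ℕ
    k = j ℕ.+ suc j′

  above-mediant : ∀ d j d′ j′ → below[ d /1+ j ] ≡ false → below[ d′ /1+ j′ ] ≡ false →
                  below[ d + d′ /1+ j ℕ.+ suc j′ ] ≡ false
  above-mediant d j d′ j′ b b′ with below[ d + d′ /1+ j ℕ.+ suc j′ ] in m
  ... | false = refl
  ... | true  = ⊥-elim (+-mono-<-≢ (below-separates (d + d′) k d j m b)
                                   (below-separates (d + d′) k d′ j′ m b′)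
                          (mediant-split d d′ (+ suc j) (+ suc j′)))
    where
    k : ℕ
    k = j ℕ.+ suc j′

  -- c·α < d; a record rather than mulLt α c d ≡ true so that c and d are inferable.
  infix 4 _·α<_
  record _·α<_ (c d : ℤ) : Set where
    constructor ⟪_⟫
    field mulLt-true : mulLt α c d ≡ true
  open _·α<_ public

  ·α<-cong : ∀ {c c′ d d′} → c ≡ c′ → d ≡ d′ → c ·α< d → c′ ·α< d′
  ·α<-cong refl refl h = h

  0·α<⇒0< : ∀ {d} → + 0 ·α< d → + 0 < d
  0·α<⇒0< {d} ⟪ h ⟫ = does-sound (+ 0 ℤP.<? d) h

  ·α<-monoʳ-≤ : ∀ {c d d′} → d ≤ d′ → c ·α< d → c ·α< d′
  ·α<-monoʳ-≤ {+ 0} {d′ = d′} d≤d′ h =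
    ⟪ does-complete (+ 0 ℤP.<? d′) (ℤP.<-≤-trans (0·α<⇒0< h) d≤d′) ⟫
  ·α<-monoʳ-≤ {+[1+ k ]} {d} {d′} d≤d′ ⟪ h ⟫ =
    ⟪ cong not (above-mono d′ k d k (ℤP.*-monoʳ-≤-nonNeg (+ suc k) d≤d′) (not-true h)) ⟫
  ·α<-monoʳ-≤ { -[1+ k ]} {d} {d′} d≤d′ ⟪ h ⟫ =
    ⟪ below-mono (- d) k (- d′) k (ℤP.*-monoʳ-≤-nonNeg (+ suc k) (ℤP.neg-mono-≤ d≤d′)) h ⟫

  ·α≮⇒·α> : ∀ {c d} → c ≢ + 0 → mulLt α c d ≡ false → - c ·α< - d
  ·α≮⇒·α> {+ 0} c≢0 _ = ⊥-elim (c≢0 refl)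
  ·α≮⇒·α> {+[1+ k ]} {d} _ h =
    ⟪ subst (λ e → below[ e /1+ k ] ≡ true) (sym (ℤP.neg-involutive d)) (not-false h) ⟫
  ·α≮⇒·α> { -[1+ k ]} _ h = ⟪ cong not h ⟫

  private
    0·α<-+ : ∀ {d c′ d′} → + 0 ·α< d → c′ ·α< d′ → (+ 0 + c′) ·α< (d + d′)
    0·α<-+ {d} {c′} {d′} h h′ = ·α<-cong (sym (ℤP.+-identityˡ c′)) refl (·α<-monoʳ-≤ d′≤d+d′ h′)
      where
      d′≤d+d′ : d′ ≤ d + d′
      d′≤d+d′ = subst (_≤ d + d′) (ℤP.+-identityˡ d′) (ℤP.+-monoˡ-≤ d′ (ℤP.<⇒≤ (0·α<⇒0< h)))

    ·α<-+-comm : ∀ c d c′ d′ → (c′ + c) ·α< (d′ + d) → (c + c′) ·α< (d + d′)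
    ·α<-+-comm c d c′ d′ = ·α<-cong (ℤP.+-comm c′ c) (ℤP.+-comm d′ d)

    1+k≡r+1+k′ : ∀ {k k′ r} → +[1+ k ] + -[1+ k′ ] ≡ r → + suc k ≡ r + + suc k′
    1+k≡r+1+k′ {k} {k′} eq = trans (a≡[a-b]+b (+ suc k) (+ suc k′)) (cong (_+ + suc k′) eq)
      where
      a≡[a-b]+b : ∀ a b → a ≡ (a - b) + b
      a≡[a-b]+b = solve-∀

    pos-gap : ∀ d d′ j a → (d + d′) * (j + a) + - d′ * (j + a) ≡ d * j + d * a
    pos-gap = solve-∀

    neg-gap : ∀ d d′ j a → - d′ * j + - d′ * (- j + a) ≡ - (d + d′) * a + d * a
    neg-gap = solve-∀

    pos+neg : ∀ {k d k′ d′} → +[1+ k ] ·α< d → -[1+ k′ ] ·α< d′ →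
              (+[1+ k ] + -[1+ k′ ]) ·α< (d + d′)
    pos+neg {k} {d} {k′} {d′} ⟪ h ⟫ ⟪ h′ ⟫ with +[1+ k ] + -[1+ k′ ] in sum
    ... | + 0 = ⟪ does-complete (+ 0 ℤP.<? d + d′)
                    (subst (_< d + d′) (ℤP.+-inverseˡ d′) (ℤP.+-monoˡ-< d′ -d′<d)) ⟫
      where
      -d′<d : - d′ < d
      -d′<d = ℤP.*-cancelʳ-<-nonNeg (+ suc k′)
                (subst (λ a → - d′ * a < d * + suc k′) (1+k≡r+1+k′ sum)
                       (below-separates (- d′) k′ d k h′ (not-true h)))
    ... | +[1+ j ] = ⟪ cong not above ⟫
      where
      above : below[ d + d′ /1+ j ] ≡ false
      above with below[ d + d′ /1+ j ] in b
      ... | false = refl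
      ... | true  = ⊥-elim (+-mono-<-≢ (below-separates (d + d′) j d k b (not-true h))
                                      (below-separates (- d′) k′ d k h′ (not-true h))
                      (trans (cong (λ a → (d + d′) * a + - d′ * a) (1+k≡r+1+k′ sum))
                             (pos-gap d d′ (+ suc j) (+ suc k′))))
    ... | -[1+ j ] = ⟪ under ⟫
      where
      under : below[ - (d + d′) /1+ j ] ≡ true
      under with below[ - (d + d′) /1+ j ] in b
      ... | true  = refl
      ... | false = ⊥-elim (+-mono-<-≢ (below-separates (- d′) k′ (- (d + d′)) j h′ b)
                                      (below-separates (- d′) k′ d k h′ (not-true h))
                      (trans (cong (λ a → - d′ * + suc j + - d′ * a) (1+k≡r+1+k′ sum))
                             (neg-gap d d′ (+ suc j) (+ suc k′))))

  ·α<-+ : ∀ {c d c′ d′} → c ·α< d → c′ ·α< d′ → (c + c′) ·α< (d + d′)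
  ·α<-+ {+ 0}                        h h′ = 0·α<-+ h h′
  ·α<-+ {c@(+[1+ _ ])} {d} {+ 0} {d′} h h′ = ·α<-+-comm c d (+ 0) d′ (0·α<-+ h′ h)
  ·α<-+ {c@(-[1+ _ ])} {d} {+ 0} {d′} h h′ = ·α<-+-comm c d (+ 0) d′ (0·α<-+ h′ h)
  ·α<-+ {+[1+ k ]} {d} {+[1+ k′ ]} {d′} ⟪ h ⟫ ⟪ h′ ⟫ =
    ⟪ cong not (above-mediant d k d′ k′ (not-true h) (not-true h′)) ⟫
  ·α<-+ { -[1+ k ]} {d} { -[1+ k′ ]} {d′} ⟪ h ⟫ ⟪ h′ ⟫ =
    ⟪ subst₂ (λ e j → below[ e /1+ j ] ≡ true) (sym (ℤP.neg-distrib-+ d d′)) (ℕP.+-suc k k′)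
             (below-mediant (- d) k (- d′) k′ h h′) ⟫
  ·α<-+ {+[1+ _ ]} {c′ = -[1+ _ ]}   h h′ = pos+neg h h′
  ·α<-+ {c@(-[1+ _ ])} {d} {c′@(+[1+ _ ])} {d′} h h′ =
    ·α<-+-comm c d c′ d′ (pos+neg h′ h)

  ·α<-cancel : ∀ {c d d′} → c ·α< d → - c ·α< d′ → + 0 < d + d′
  ·α<-cancel {c} h h′ = 0·α<⇒0< (·α<-cong (ℤP.+-inverseʳ c) refl (·α<-+ h h′))

  ·α<-asym : ∀ {c d} → c ·α< d → - c ·α< - d → ⊥
  ·α<-asym {d = d} h h′ = ℤP.<-irrefl (sym (ℤP.+-inverseʳ d)) (·α<-cancel h h′)

  below-↥/↧ : ∀ q → below α q ≡ below[ ℚ.↥ q /1+ ℚ.denominator-1 q ]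
  below-↥/↧ q@record{} = cong (below α) (sym (ℚP.↥p/↧p≡p q))

  ∃-below : ∀ j → ∃ λ e → below[ e /1+ j ] ≡ true
  ∃-below j with lowerInhabited α
  ... | q , q<α with ℚ.↥ q | ℚ.denominator-1 q | trans (sym (below-↥/↧ q)) q<α
  ...   | + m      | i | m/i<α =
    + 0 , below-mono (+ m) i (+ 0) j (ℤP.*-monoʳ-≤-nonNeg (+ suc j) {+ 0} {+ m} (ℤ.+≤+ ℕ.z≤n))
                     m/i<α
  ...   | -[1+ m ] | i | m/i<α =
    e , below-mono -[1+ m ] i e j
          (ℤP.≤-trans (ℤP.*-monoˡ-≤-nonPos e (ℤ.+≤+ (ℕ.s≤s ℕ.z≤n)))
                      (ℤP.≤-reflexive (ℤP.*-identityʳ e)))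
          m/i<α
    where
    e : ℤ
    e = -[1+ m ] * + suc j

  ∃-above : ∀ j → ∃ λ e → below[ e /1+ j ] ≡ false
  ∃-above j with upperInhabited α
  ... | q , α<q with ℚ.↥ q | ℚ.denominator-1 q | trans (sym (below-↥/↧ q)) α<q
  ...   | + m      | i | α<m/i =
    e , above-mono e j (+ m) i
          (ℤP.≤-trans (ℤP.≤-reflexive (sym (ℤP.*-identityʳ e)))
                      (ℤP.*-monoˡ-≤-nonNeg e {{ℤ.nonNegative 0≤e}} (ℤ.+≤+ (ℕ.s≤s ℕ.z≤n))))
          α<m/i
    where
    e : ℤ
    e = + m * + suc j
    0≤e : + 0 ≤ e
    0≤e = ℤP.*-monoʳ-≤-nonNeg (+ suc j) {+ 0} {+ m} (ℤ.+≤+ ℕ.z≤n)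
  ...   | -[1+ m ] | i | α<m/i = + 0 , above-mono (+ 0) j -[1+ m ] i ℤ.-≤+ α<m/i

  floor-exists : ∀ t → ∃ (IsFloor α (suc t))
  floor-exists t = lo + + i , mulLt-true lower , mulLt-true upper
    where
    lo hi : ℤ
    lo = proj₁ (∃-below t)
    hi = proj₁ (∃-above t)
    lo+_below : ℕ → Bool
    lo+ i below = below[ lo + + i /1+ t ]
    lo+0-below : lo+ 0 below ≡ true
    lo+0-below =
      subst (λ e → below[ e /1+ t ] ≡ true) (sym (ℤP.+-identityʳ lo)) (proj₂ (∃-below t))
    hi≤lo+∣hi-lo∣ : hi ≤ lo + + ℤ.∣ hi - lo ∣
    hi≤lo+∣hi-lo∣ =
      subst (_≤ lo + + ℤ.∣ hi - lo ∣) (lo+[hi-lo]≡hi lo hi) (ℤP.+-monoʳ-≤ lo (i≤+∣i∣ (hi - lo)))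
      where
      lo+[hi-lo]≡hi : ∀ lo hi → lo + (hi - lo) ≡ hi
      lo+[hi-lo]≡hi = solve-∀
    lo+∣hi-lo∣-above : lo+ ℤ.∣ hi - lo ∣ below ≡ false
    lo+∣hi-lo∣-above = above-mono (lo + + ℤ.∣ hi - lo ∣) t hi t
      (ℤP.*-monoʳ-≤-nonNeg (+ suc t) hi≤lo+∣hi-lo∣) (proj₂ (∃-above t))
    crossing : ∃ λ i → lo+ i below ≡ true × lo+ suc i below ≡ false
    crossing = ∃-true-then-false lo+_below lo+0-below ℤ.∣ hi - lo ∣ lo+∣hi-lo∣-above
    i : ℕ
    i = proj₁ crossing
    lower : - + suc t ·α< - (lo + + i)
    lower = ⟪ subst (λ e → below[ e /1+ t ] ≡ true) (sym (ℤP.neg-involutive (lo + + i)))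
                    (proj₁ (proj₂ crossing)) ⟫
    upper : + suc t ·α< (lo + + i) + + 1
    upper = ⟪ cong not (subst (λ e → below[ e /1+ t ] ≡ false) (lo+[1+i]≡[lo+i]+1 lo (+ i))
                              (proj₂ (proj₂ crossing))) ⟫
      where
      lo+[1+i]≡[lo+i]+1 : ∀ lo i → lo + (+ 1 + i) ≡ (lo + i) + + 1
      lo+[1+i]≡[lo+i]+1 = solve-∀

  ⌊_·α⌋ : ℕ → ℤ
  ⌊ zero  ·α⌋ = + 0
  ⌊ suc t ·α⌋ = proj₁ (floor-exists t)

  ⌊⌋-isFloor : ∀ {n} → 1 ℕ.≤ n → IsFloor α n ⌊ n ·α⌋
  ⌊⌋-isFloor {suc t} _ = proj₂ (floor-exists t)

  ⌊⌋-lower : ∀ {n} → 1 ℕ.≤ n → - + n ·α< - ⌊ n ·α⌋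
  ⌊⌋-lower 1≤n = ⟪ proj₁ (⌊⌋-isFloor 1≤n) ⟫

  ⌊⌋-upper : ∀ {n} → 1 ℕ.≤ n → + n ·α< ⌊ n ·α⌋ + + 1
  ⌊⌋-upper 1≤n = ⟪ proj₂ (⌊⌋-isFloor 1≤n) ⟫

  floor-< : ∀ n a b → IsFloor α n a → IsFloor α n b → b < a + + 1
  floor-< n a b (_ , a-upper) (b-lower , _) =
    0<i-j⇒j<i (·α<-cancel {+ n} {a + + 1} { - b} ⟪ a-upper ⟫ ⟪ b-lower ⟫)

  floor-unique : ∀ n a b → IsFloor α n a → IsFloor α n b → a ≡ b
  floor-unique n a b fa fb = ℤP.≤-antisym (floor-≤ a b fa fb) (floor-≤ b a fb fa)
    where
    floor-≤ : ∀ a b → IsFloor α n a → IsFloor α n b → a ≤ b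
    floor-≤ a b fa fb = ℤP.≮⇒≥ λ b<a → ℤP.<-irrefl refl
      (ℤP.<-≤-trans (floor-< n b a fb fa) (subst (_≤ a) (ℤP.+-comm (+ 1) b) (ℤP.i<j⇒suc[i]≤j b<a)))

  infix 5 _<ᶠ_
  _<ᶠ_ : ℕ → ℕ → Bool
  m <ᶠ n = mulLt α (+ m - + n) (⌊ m ·α⌋ - ⌊ n ·α⌋)

  <ᶠ⇒·α< : ∀ m n → m <ᶠ n ≡ true → + m - + n ·α< ⌊ m ·α⌋ - ⌊ n ·α⌋
  <ᶠ⇒·α< m n = ⟪_⟫

  FracLt⇒<ᶠ : ∀ {m n} → 1 ℕ.≤ m → 1 ℕ.≤ n → FracLt α m n → m <ᶠ n ≡ true
  FracLt⇒<ᶠ {m} {n} 1≤m 1≤n (a , b , fa , fb , lt) =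
    subst₂ (λ a b → mulLt α (+ m - + n) (a - b) ≡ true)
           (floor-unique m a ⌊ m ·α⌋ fa (⌊⌋-isFloor 1≤m))
           (floor-unique n b ⌊ n ·α⌋ fb (⌊⌋-isFloor 1≤n)) lt

  <ᶠ⇒FracLt : ∀ {m n} → 1 ℕ.≤ m → 1 ℕ.≤ n → m <ᶠ n ≡ true → FracLt α m n
  <ᶠ⇒FracLt {m} {n} 1≤m 1≤n lt = ⌊ m ·α⌋ , ⌊ n ·α⌋ , ⌊⌋-isFloor 1≤m , ⌊⌋-isFloor 1≤n , lt

  <ᶠ-asym : ∀ m n → m <ᶠ n ≡ true → n <ᶠ m ≡ false
  <ᶠ-asym m n m<n with n <ᶠ m in n<m
  ... | false = refl
  ... | true  = ⊥-elim (·α<-asym (<ᶠ⇒·α< m n m<n)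
                  (·α<-cong (i-j≡-[j-i] (+ n) (+ m)) (i-j≡-[j-i] ⌊ n ·α⌋ ⌊ m ·α⌋) (<ᶠ⇒·α< n m n<m)))

  CycBetween⇒maj : ∀ {x z y} → 1 ℕ.≤ x → 1 ℕ.≤ z → 1 ℕ.≤ y →
                   CycBetween α x z y → maj (x <ᶠ z) (z <ᶠ y) (y <ᶠ x) ≡ true
  CycBetween⇒maj hx hz hy (inj₁ (p , q)) =
    maj-intro (inj₁ (FracLt⇒<ᶠ hx hz p , FracLt⇒<ᶠ hz hy q))
  CycBetween⇒maj hx hz hy (inj₂ (inj₁ (p , q))) =
    maj-intro (inj₂ (inj₁ (FracLt⇒<ᶠ hz hy p , FracLt⇒<ᶠ hy hx q)))
  CycBetween⇒maj hx hz hy (inj₂ (inj₂ (p , q))) =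
    maj-intro (inj₂ (inj₂ (FracLt⇒<ᶠ hy hx p , FracLt⇒<ᶠ hx hz q)))

  maj⇒CycBetween : ∀ {x z y} → 1 ℕ.≤ x → 1 ℕ.≤ z → 1 ℕ.≤ y →
                   maj (x <ᶠ z) (z <ᶠ y) (y <ᶠ x) ≡ true → CycBetween α x z y
  maj⇒CycBetween hx hz hy m with maj-elim m
  ... | inj₁ (p , q)        = inj₁ (<ᶠ⇒FracLt hx hz p , <ᶠ⇒FracLt hz hy q)
  ... | inj₂ (inj₁ (p , q)) = inj₂ (inj₁ (<ᶠ⇒FracLt hz hy p , <ᶠ⇒FracLt hy hx q))
  ... | inj₂ (inj₂ (p , q)) = inj₂ (inj₂ (<ᶠ⇒FracLt hy hx p , <ᶠ⇒FracLt hx hz q))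

  borrow : Bool → ℤ
  borrow true  = + 0
  borrow false = + 1

  module Reflection (K : ℕ) where

    1≤_<K : ℕ → Set
    1≤ s <K = 1 ℕ.≤ s × s ℕ.< K

    private
      1≤K : ∀ {s} → 1≤ s <K → 1 ℕ.≤ K
      1≤K (1≤s , s<K) = ℕP.≤-trans 1≤s (ℕP.<⇒≤ s<K)

      1≤K∸s : ∀ {s} → 1≤ s <K → 1 ℕ.≤ K ∸ s
      1≤K∸s (_ , s<K) = ℕP.m<n⇒0<n∸m s<K

      +[K∸s]≡K-s : ∀ {s} → 1≤ s <K → + (K ∸ s) ≡ + K - + s
      +[K∸s]≡K-s (_ , s<K) = +[m∸n]≡m-n (ℕP.<⇒≤ s<K)

      s-K≢0 : ∀ {s} → s ℕ.< K → + s - + K ≢ + 0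
      s-K≢0 {s} s<K eq = ℕP.<⇒≢ s<K (ℤP.+-injective (ℤP.i-j≡0⇒i≡j (+ s) (+ K) eq))

    ⌊⌋-reflect : ∀ {s} → 1≤ s <K → ⌊ K ∸ s ·α⌋ ≡ (⌊ K ·α⌋ - ⌊ s ·α⌋) - borrow (s <ᶠ K)
    ⌊⌋-reflect {s} s∈ =
      floor-unique (K ∸ s) _ _ (⌊⌋-isFloor (1≤K∸s s∈)) (IsFloor-reflect (s <ᶠ K) refl)
      where
      k x : ℤ
      k = ⌊ K ·α⌋
      x = ⌊ s ·α⌋
      -[K∸s]≡s-K : - + (K ∸ s) ≡ + s - + K
      -[K∸s]≡s-K = trans (cong -_ (+[K∸s]≡K-s s∈)) (sym (i-j≡-[j-i] (+ s) (+ K)))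
      IsFloor-reflect : ∀ e → s <ᶠ K ≡ e → IsFloor α (K ∸ s) ((k - x) - borrow e)
      IsFloor-reflect true s<ᶠK =
          mulLt-true (·α<-cong (sym -[K∸s]≡s-K) (lower-eq k x) (<ᶠ⇒·α< s K s<ᶠK))
        , mulLt-true (·α<-cong (sym (+[K∸s]≡K-s s∈)) (upper-eq k x)
                               (·α<-+ (⌊⌋-upper (1≤K s∈)) (⌊⌋-lower (proj₁ s∈))))
        where
        lower-eq : ∀ k x → x - k ≡ - ((k - x) - + 0)
        lower-eq = solve-∀
        upper-eq : ∀ k x → (k + + 1) - x ≡ ((k - x) - + 0) + + 1
        upper-eq = solve-∀
      IsFloor-reflect false s≮ᶠK =
          mulLt-true (·α<-cong (sym -[K∸s]≡s-K) (lower-eq k x)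
                               (·α<-+ (⌊⌋-upper (proj₁ s∈)) (⌊⌋-lower (1≤K s∈))))
        , mulLt-true (·α<-cong -[s-K]≡K∸s (upper-eq k x) (·α≮⇒·α> (s-K≢0 (proj₂ s∈)) s≮ᶠK))
        where
        lower-eq : ∀ k x → (x + + 1) - k ≡ - ((k - x) - + 1)
        lower-eq = solve-∀
        upper-eq : ∀ k x → - (x - k) ≡ ((k - x) - + 1) + + 1
        upper-eq = solve-∀
        -[s-K]≡K∸s : - (+ s - + K) ≡ + (K ∸ s)
        -[s-K]≡K∸s = trans (cong -_ (sym -[K∸s]≡s-K)) (ℤP.neg-involutive _)

    <ᶠ-reflect : ∀ {s t} → 1≤ s <K → 1≤ t <K →
      (K ∸ s) <ᶠ (K ∸ t) ≡
      mulLt α (+ t - + s) ((⌊ t ·α⌋ - ⌊ s ·α⌋) + (borrow (t <ᶠ K) - borrow (s <ᶠ K)))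
    <ᶠ-reflect {s} {t} s∈ t∈ = cong₂ (mulLt α)
      (trans (cong₂ _-_ (+[K∸s]≡K-s s∈) (+[K∸s]≡K-s t∈)) (coefficients (+ K) (+ s) (+ t)))
      (trans (cong₂ _-_ (⌊⌋-reflect s∈) (⌊⌋-reflect t∈))
             (floors ⌊ K ·α⌋ ⌊ s ·α⌋ ⌊ t ·α⌋ (borrow (s <ᶠ K)) (borrow (t <ᶠ K))))
      where
      coefficients : ∀ k x y → (k - x) - (k - y) ≡ y - x
      coefficients = solve-∀
      floors : ∀ k x y b c → ((k - x) - b) - ((k - y) - c) ≡ (y - x) + (c - b)
      floors = solve-∀

    <ᶠ-reflect-same : ∀ {s t} → 1≤ s <K → 1≤ t <K →
                      s <ᶠ K ≡ t <ᶠ K → (K ∸ s) <ᶠ (K ∸ t) ≡ t <ᶠ s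
    <ᶠ-reflect-same {s} {t} s∈ t∈ same rewrite <ᶠ-reflect s∈ t∈ | same =
      cong (mulLt α (+ t - + s)) (x+[b-b]≡x (⌊ t ·α⌋ - ⌊ s ·α⌋) (borrow (t <ᶠ K)))
      where
      x+[b-b]≡x : ∀ x b → x + (b - b) ≡ x
      x+[b-b]≡x = solve-∀

    <ᶠ-reflect-cross : ∀ {s t} → 1≤ s <K → 1≤ t <K →
                       s <ᶠ K ≡ true → t <ᶠ K ≡ false → (K ∸ s) <ᶠ (K ∸ t) ≡ true
    <ᶠ-reflect-cross {s} {t} s∈ t∈ s<ᶠK t≮ᶠK rewrite <ᶠ-reflect s∈ t∈ | s<ᶠK | t≮ᶠK =
      mulLt-true (·α<-cong refl (floors ⌊ t ·α⌋ ⌊ s ·α⌋)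
                           (·α<-+ (⌊⌋-upper (proj₁ t∈)) (⌊⌋-lower (proj₁ s∈))))
      where
      floors : ∀ y x → (y + + 1) - x ≡ (y - x) + (+ 1 - + 0)
      floors = solve-∀

    <ᶠ-cut : ∀ {s t} → t ℕ.< K → s <ᶠ K ≡ true → t <ᶠ K ≡ false → s <ᶠ t ≡ true
    <ᶠ-cut {s} {t} t<K s<ᶠK t≮ᶠK =
      mulLt-true (·α<-cong (differences (+ s) (+ t) (+ K)) (differences ⌊ s ·α⌋ ⌊ t ·α⌋ ⌊ K ·α⌋)
                           (·α<-+ (<ᶠ⇒·α< s K s<ᶠK) (·α≮⇒·α> (s-K≢0 t<K) t≮ᶠK)))
      where
      differences : ∀ x y k → (x - k) + - (y - k) ≡ x - y
      differences = solve-∀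

    <ᶠ-across-cut : ∀ {s t} → 1≤ s <K → 1≤ t <K → s <ᶠ K ≢ t <ᶠ K → t <ᶠ s ≡ t <ᶠ K
    <ᶠ-across-cut {s} {t} (_ , s<K) (_ , t<K) differ with s <ᶠ K in es | t <ᶠ K in et
    ... | true  | true  = ⊥-elim (differ refl)
    ... | false | false = ⊥-elim (differ refl)
    ... | true  | false = <ᶠ-asym s t (<ᶠ-cut t<K es et)
    ... | false | true  = <ᶠ-cut s<K et es

    <ᶠ-reflect-xor : ∀ {s t} → 1≤ s <K → 1≤ t <K →
                     (K ∸ s) <ᶠ (K ∸ t) ≡ ((s <ᶠ K) xor (t <ᶠ K)) xor (t <ᶠ s)
    <ᶠ-reflect-xor {s} {t} s∈ t∈ with s <ᶠ K in es | t <ᶠ K in et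
    ... | true  | true  = <ᶠ-reflect-same s∈ t∈ (trans es (sym et))
    ... | false | false = <ᶠ-reflect-same s∈ t∈ (trans es (sym et))
    ... | true  | false = trans (<ᶠ-reflect-cross s∈ t∈ es et)
                                (sym (cong not (<ᶠ-asym s t (<ᶠ-cut (proj₂ t∈) es et))))
    ... | false | true  = trans (<ᶠ-asym (K ∸ t) (K ∸ s) (<ᶠ-reflect-cross t∈ s∈ et es))
                                (sym (cong not (<ᶠ-cut (proj₂ s∈) et es)))

    CycBetween-reflect : ∀ {a b c} → 1≤ a <K → 1≤ b <K → 1≤ c <K →
                         CycBetween α (K ∸ a) (K ∸ b) (K ∸ c) → CycBetween α c b a
    CycBetween-reflect {a} {b} {c} a∈ b∈ c∈ cyc =
      maj⇒CycBetween (proj₁ c∈) (proj₁ b∈) (proj₁ a∈) (begin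
      maj (c <ᶠ b) (b <ᶠ a) (a <ᶠ c)
        ≡⟨ maj-comm (c <ᶠ b) (b <ᶠ a) (a <ᶠ c) ⟩
      maj (b <ᶠ a) (c <ᶠ b) (a <ᶠ c)
        ≡⟨ maj-flip-across-cut (a <ᶠ K) (b <ᶠ K) (c <ᶠ K) (b <ᶠ a) (c <ᶠ b) (a <ᶠ c)
             (<ᶠ-across-cut a∈ b∈) (<ᶠ-across-cut b∈ c∈) (<ᶠ-across-cut c∈ a∈) ⟨
      maj (((a <ᶠ K) xor (b <ᶠ K)) xor (b <ᶠ a))
          (((b <ᶠ K) xor (c <ᶠ K)) xor (c <ᶠ b))
          (((c <ᶠ K) xor (a <ᶠ K)) xor (a <ᶠ c))
        ≡⟨ maj-cong (<ᶠ-reflect-xor a∈ b∈) (<ᶠ-reflect-xor b∈ c∈) (<ᶠ-reflect-xor c∈ a∈) ⟨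
      maj ((K ∸ a) <ᶠ (K ∸ b)) ((K ∸ b) <ᶠ (K ∸ c)) ((K ∸ c) <ᶠ (K ∸ a))
        ≡⟨ CycBetween⇒maj (1≤K∸s a∈) (1≤K∸s b∈) (1≤K∸s c∈) cyc ⟩
      true ∎)
      where open ≡-Reasoning

  CycSucc-reflect : ∀ {N m n} → 1 ℕ.≤ m × m ℕ.≤ N → 1 ℕ.≤ n × n ℕ.≤ N →
                    CycSucc α N m n → CycSucc α N (suc N ∸ n) (suc N ∸ m)
  CycSucc-reflect {N} {m} {n} (1≤m , m≤N) (1≤n , n≤N) (m≡n⇒N≡1 , nothing-between) =
    (λ eq → m≡n⇒N≡1 (sym (ℕP.∸-cancelˡ-≡ (ℕP.m≤n⇒m≤1+n n≤N) (ℕP.m≤n⇒m≤1+n m≤N) eq))) ,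
    nothing-between-reflected
    where
    open Reflection (suc N)
    nothing-between-reflected : ∀ p → 1 ℕ.≤ p → p ℕ.≤ N → ¬ CycBetween α (suc N ∸ n) p (suc N ∸ m)
    nothing-between-reflected p 1≤p p≤N between =
      nothing-between p′ (proj₁ p′∈) (ℕP.∸-monoʳ-≤ (suc N) 1≤p)
        (CycBetween-reflect (1≤n , ℕ.s≤s n≤N) p′∈ (1≤m , ℕ.s≤s m≤N)
          (subst (λ q → CycBetween α (suc N ∸ n) q (suc N ∸ m))
                 (sym (ℕP.m∸[m∸n]≡n (ℕP.m≤n⇒m≤1+n p≤N))) between))
      where
      p′ : ℕ
      p′ = suc N ∸ p
      p′∈ : 1≤ p′ <K
      p′∈ = ℕP.m<n⇒0<n∸m (ℕ.s≤s p≤N) , ℕ.s≤s (ℕP.∸-monoʳ-≤ (suc N) 1≤p)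

Consecutive-reverse-map : ∀ α N {P : ℕ → Set} (f : ℕ → ℕ) →
  (∀ {m n} → P m → P n → CycSucc α N m n → CycSucc α N (f n) (f m)) →
  ∀ {ns} → All P ns → Consecutive α N ns → Consecutive α N (reverse (map f ns))
Consecutive-reverse-map α N {P} f step {[]}     _   _   = tt
Consecutive-reverse-map α N {P} f step {x ∷ xs} Pxs cxs = go xs [] Pxs cxs tt
  where
  go : ∀ {x} xs acc → All P (x ∷ xs) → Consecutive α N (x ∷ xs) →
       Consecutive α N (f x ∷ acc) → Consecutive α N (reverseAcc (f x ∷ acc) (map f xs))
  go []       acc _                 _          done = done
  go (y ∷ ys) acc (Px ∷ Py ∷ Pys) (xy , cys) done =
    go ys (f _ ∷ acc) (Py ∷ Pys) cys (step Px Py xy , done)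

lemma3p1 : (α : IrrationalReal) (N : ℕ) → 1 ℕ.≤ N → (ns : List ℕ) →
    All (λ n → 1 ℕ.≤ n × n ℕ.≤ N) ns →
    Consecutive α N ns →
    Consecutive α N (reflectList N ns)
lemma3p1 α N _ ns = Consecutive-reverse-map α N (suc N ∸_) (CycSucc-reflect α)
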